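{- Let $q\ge 2$ be a prime power, $r_1,r_2\ge 1$, and let $\tau_1$ and $\tau_2$ be permutations of $F_q^{r_1}$ and $F_q^{r_2}$ with distensions $l_1$ and $l_2$ respectively, such that $\tau_1({\bf 0})={\bf 0}$ and $\tau_2({\bf 0})={\bf 0}$. Then the distension of the permutation $\tau_1|\tau_2$ of $F_q^{r_1+r_2}$ is $l_1+l_2$.
   Context: For $r\ge 1$ let $D^{(r)}$ be the linear code of length $q^r$ over $F_q$ with coordinate positions indexed by vectors of $F_q^r$, $D^{(r)}=\{y=(y_c)_{c\in F_q^r}: \sum_c y_c=0,\ \sum_c y_c c={\bf 0}\}$. A permutation $\tau$ of $F_q^r$ acts on vectors of length $q^r$ by permuting positions ($e_c\mapsto e_{\tau(c)}$, where $e_c$ is the unit vector at position $c$, extended linearly). The distension of $\tau$ is $\dim D^{(r)}-\dim(D^{(r)}\cap\tau(D^{(r)}))$. For permutations $\tau_1$ of $F_q^{r_1}$ and $\tau_2$ of $F_q^{r_2}$, $\tau_1|\tau_2$ is the permutation of $F_q^{r_1+r_2}$ defined by $(\tau_1|\tau_2)\binom{a}{b}=\binom{\tau_1(a)}{\tau_2(b)}$ for $a\in F_q^{r_1}$, $b\in F_q^{r_2}$. -}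

module Defs where

open import Level using (0ℓ) renaming (suc to lsuc)
open import Algebra.Bundles using (CommutativeRing)
open import Data.Nat as ℕ using (ℕ; zero; suc)
open import Data.Fin using (Fin)
open import Data.List as List using (List; []; _∷_; allFin; concatMap)
open import Data.Vec as Vec using (Vec; []; _∷_; lookup; take; drop; _++_)
open import Data.Product using (Σ; ∃; ∃₂; _×_; _,_)
open import Relation.Nullary using (¬_)
open import Relation.Binary.PropositionalEquality using (_≡_; refl; cong; cong₂; trans; sym)
open import Function.Bundles using (_↔_; Inverse; mk↔ₛ′)

record FiniteField (q : ℕ) : Set₁ where
  field
    commRing : CommutativeRing 0ℓ 0ℓ
  open CommutativeRing commRing public hiding (ring)
  field
    ≈⇒≡     : ∀ {x y} → x ≈ y → x ≡ y
    0≉1     : ¬ (0# ≈ 1#)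
    inverse : ∀ x → ¬ (x ≈ 0#) → ∃ λ y → x * y ≈ 1#
    enum    : Carrier ↔ Fin q

take-++ : ∀ {A : Set} m {n} (xs : Vec A m) (ys : Vec A n) → take m (xs ++ ys) ≡ xs
take-++ zero [] ys = refl
take-++ (suc m) (x ∷ xs) ys = cong (x ∷_) (take-++ m xs ys)

drop-++ : ∀ {A : Set} m {n} (xs : Vec A m) (ys : Vec A n) → drop m (xs ++ ys) ≡ ys
drop-++ zero [] ys = refl
drop-++ (suc m) (x ∷ xs) ys = drop-++ m xs ys

take++drop : ∀ {A : Set} m {n} (xs : Vec A (m ℕ.+ n)) → take m xs ++ drop m xs ≡ xs
take++drop zero xs = refl
take++drop (suc m) (x ∷ xs) = cong (x ∷_) (take++drop m xs)

module Code {q : ℕ} (F : FiniteField q) where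
  open FiniteField F using (Carrier; _≈_; _+_; _*_; 0#; enum)

  Pt : ℕ → Set
  Pt r = Vec Carrier r

  elems : List Carrier
  elems = List.map (Inverse.from enum) (allFin q)

  allPts : (r : ℕ) → List (Pt r)
  allPts zero    = [] ∷ []
  allPts (suc r) = concatMap (λ x → List.map (x ∷_) (allPts r)) elems

  -- vectors of length q^r over F_q, indexed by the points of F_q^r
  Word : ℕ → Set
  Word r = Pt r → Carrier

  sumL : List Carrier → Carrier
  sumL = List.foldr _+_ 0#

  Σpts : (r : ℕ) → (Pt r → Carrier) → Carrier
  Σpts r f = sumL (List.map f (allPts r))

  D : (r : ℕ) → Word r → Set
  D r y = (Σpts r y ≈ 0#) × (∀ (i : Fin r) → Σpts r (λ c → y c * lookup c i) ≈ 0#)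

  Perm : ℕ → Set
  Perm r = Pt r ↔ Pt r

  -- action on words: e_c ↦ e_{τ c}, i.e. (τ y)_d = y_{τ⁻¹ d}
  act : ∀ {r} → Perm r → Word r → Word r
  act τ y d = y (Inverse.from τ d)

  Image : ∀ {r} → Perm r → (Word r → Set) → Word r → Set
  Image τ S z = ∃ λ y → S y × (∀ d → z d ≈ act τ y d)

  _∩_ : ∀ {r} → (Word r → Set) → (Word r → Set) → Word r → Set
  (S ∩ T) y = S y × T y

  comb : ∀ {r d} → Vec Carrier d → Vec (Word r) d → Word r
  comb []       []       c = 0#
  comb (a ∷ as) (b ∷ bs) c = a * b c + comb as bs c

  LinIndep : ∀ {r d} → Vec (Word r) d → Set
  LinIndep {r} {d} bs = ∀ (as : Vec Carrier d) → (∀ c → comb as bs c ≈ 0#) → ∀ i → lookup as i ≈ 0#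

  Spans : ∀ {r d} → (Word r → Set) → Vec (Word r) d → Set
  Spans {r} {d} S bs = ∀ y → S y → ∃ λ (as : Vec Carrier d) → ∀ c → y c ≈ comb as bs c

  HasDim : ∀ r → (Word r → Set) → ℕ → Set
  HasDim r S d = ∃ λ (bs : Vec (Word r) d) → (∀ i → S (lookup bs i)) × LinIndep bs × Spans S bs

  Distension : ∀ r → Perm r → ℕ → Set
  Distension r τ l = ∃₂ λ a b → HasDim r (D r) a × HasDim r (D r ∩ Image τ (D r)) b × (a ≡ l ℕ.+ b)

  zeroPt : ∀ r → Pt r
  zeroPt r = Vec.replicate r 0#

  bar : ∀ {r₁ r₂} → Perm r₁ → Perm r₂ → Perm (r₁ ℕ.+ r₂)
  bar {r₁} {r₂} τ₁ τ₂ = mk↔ₛ′ f g fg gf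
    where
      module T₁ = Inverse τ₁
      module T₂ = Inverse τ₂
      f : Pt (r₁ ℕ.+ r₂) → Pt (r₁ ℕ.+ r₂)
      f v = T₁.to (take r₁ v) ++ T₂.to (drop r₁ v)
      g : Pt (r₁ ℕ.+ r₂) → Pt (r₁ ℕ.+ r₂)
      g v = T₁.from (take r₁ v) ++ T₂.from (drop r₁ v)
      fg : ∀ v → f (g v) ≡ v
      fg v = trans (cong₂ _++_
                      (trans (cong T₁.to (take-++ r₁ _ _)) (T₁.strictlyInverseˡ _))
                      (trans (cong T₂.to (drop-++ r₁ (T₁.from (take r₁ v)) _)) (T₂.strictlyInverseˡ _)))
                   (take++drop r₁ v)
      gf : ∀ v → g (f v) ≡ v
      gf v = trans (cong₂ _++_
                      (trans (cong T₁.from (take-++ r₁ _ _)) (T₁.strictlyInverseʳ _))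
                      (trans (cong T₂.from (drop-++ r₁ (T₁.to (take r₁ v)) _)) (T₂.strictlyInverseʳ _)))
                   (take++drop r₁ v)

module Submission where

-- Split a word z on F_q^(r₁+r₂) = F_q^r₁ × F_q^r₂ into its marginals z₁ x = Σ_y z (x , y) and
-- z₂ y = Σ_x z (x , y).  The parity checks of D^(r₁+r₂) split along the two blocks of coordinates, so
-- z ∈ D^(r₁+r₂) iff z₁ ∈ D^(r₁) and z₂ ∈ D^(r₂); and as the marginals of z ∘ (τ₁|τ₂) are z₁ ∘ τ₁ and
-- z₂ ∘ τ₂, likewise z ∈ (τ₁|τ₂)(D^(r₁+r₂)) iff zᵢ ∈ τᵢ(D^(rᵢ)).  For sets P₁, P₂ of zero-sum words, the
-- marginal maps split (by u ↦ u ⊗ e₀ and v ↦ e₀ ⊗ v), so the words with marginals in P₁ and P₂ have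
-- dimension dim K + dim P₁ + dim P₂, where K, the words with both marginals zero, does not depend on the
-- Pᵢ.  Applied to D and to D ∩ τ(D), the common term dim K cancels and the distensions add.

open import Defs
open import Data.Nat as ℕ using (ℕ; _≥_)
open import Data.Nat.Solver using (module +-*-Solver)
open import Algebra.Bundles using (CommutativeRing)
import Algebra.Properties.Ring as RingProperties
import Algebra.Properties.CommutativeSemigroup as CommutativeSemigroupProperties
open import Data.Empty using (⊥-elim)
open import Data.Fin as Fin using (Fin; zero; suc)
import Data.Fin.Properties as Fin
open import Data.List as L using (List; []; _∷_)
open import Data.List.Membership.Propositional using (_∈_)
import Data.List.Membership.Propositional.Properties as ∈
open import Data.List.Relation.Unary.All using (All; []; _∷_)
import Data.List.Relation.Unary.All as All
open import Data.List.Relation.Unary.Any using (here; there)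
import Data.List.Relation.Unary.Any as Any
import Data.List.Relation.Unary.Any.Properties as Any
open import Data.List.Relation.Unary.AllPairs using ([]; _∷_)
open import Data.List.Relation.Unary.Unique.Propositional using (Unique)
import Data.List.Relation.Unary.Unique.Propositional.Properties as Unique
open import Data.Product using (∃; _×_; _,_; proj₁; proj₂)
open import Data.Sum using (inj₁; inj₂)
open import Data.Vec as V using (Vec; []; _∷_; lookup; take; drop; _++_)
import Data.Vec.Properties as V
import Data.Vec.Relation.Unary.All.Properties as VecAll
open import Function.Bundles using (Inverse)
open import Function.Properties.Inverse using (↔⇒↣)
open import Relation.Nullary using (Dec; yes; no)
open import Relation.Nullary.Decidable using (via-injection; ¬?; _×-dec_)
open import Relation.Binary.PropositionalEquality
  using (_≡_; _≢_; refl; sym; trans; cong; cong₂; subst; module ≡-Reasoning)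
open ≡-Reasoning

module _ {q : ℕ} (F : FiniteField q) where

  open FiniteField F using (Carrier; _≈_; _+_; _*_; -_; _-_; 0#; 1#; ≈⇒≡; commRing; enum)
  open Code F

  private
    module CR = CommutativeRing commRing
    module RP = RingProperties CR.ring
    module +P = CommutativeSemigroupProperties CR.+-commutativeSemigroup

  -- Equality in F is propositional equality, so the ring laws are restated with _≡_ to allow cong and ≡-Reasoning.
  ≡⇒≈ : ∀ {x y} → x ≡ y → x ≈ y
  ≡⇒≈ refl = CR.refl

  +-assoc : ∀ x y z → (x + y) + z ≡ x + (y + z)
  +-assoc x y z = ≈⇒≡ (CR.+-assoc x y z)

  +-identityˡ : ∀ x → 0# + x ≡ x
  +-identityˡ x = ≈⇒≡ (CR.+-identityˡ x)

  +-identityʳ : ∀ x → x + 0# ≡ x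
  +-identityʳ x = ≈⇒≡ (CR.+-identityʳ x)

  +-interchange : ∀ a b c d → (a + b) + (c + d) ≡ (a + c) + (b + d)
  +-interchange a b c d = ≈⇒≡ (+P.interchange a b c d)

  *-comm : ∀ x y → x * y ≡ y * x
  *-comm x y = ≈⇒≡ (CR.*-comm x y)

  *-assoc : ∀ x y z → (x * y) * z ≡ x * (y * z)
  *-assoc x y z = ≈⇒≡ (CR.*-assoc x y z)

  *-identityˡ : ∀ x → 1# * x ≡ x
  *-identityˡ x = ≈⇒≡ (CR.*-identityˡ x)

  *-identityʳ : ∀ x → x * 1# ≡ x
  *-identityʳ x = ≈⇒≡ (CR.*-identityʳ x)

  *-zeroˡ : ∀ x → 0# * x ≡ 0#
  *-zeroˡ x = ≈⇒≡ (CR.zeroˡ x)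

  *-zeroʳ : ∀ x → x * 0# ≡ 0#
  *-zeroʳ x = ≈⇒≡ (CR.zeroʳ x)

  *-distribˡ-+ : ∀ a x y → a * (x + y) ≡ a * x + a * y
  *-distribˡ-+ a x y = ≈⇒≡ (CR.distribˡ a x y)

  *-distribʳ-+ : ∀ a x y → (x + y) * a ≡ x * a + y * a
  *-distribʳ-+ a x y = ≈⇒≡ (CR.distribʳ a x y)

  -0#≡0# : - 0# ≡ 0#
  -0#≡0# = ≈⇒≡ RP.-0#≈0#

  -‿+-comm : ∀ x y → - x + - y ≡ - (x + y)
  -‿+-comm x y = ≈⇒≡ (RP.-‿+-comm x y)

  -1*x≡-x : ∀ x → - 1# * x ≡ - x
  -1*x≡-x x = ≈⇒≡ (RP.-1*x≈-x x)

  x≡y⇒x-y≡0 : ∀ {x y} → x ≡ y → x - y ≡ 0#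
  x≡y⇒x-y≡0 refl = ≈⇒≡ (CR.-‿inverseʳ _)

  x-y≡0⇒x≡y : ∀ x y → x - y ≡ 0# → x ≡ y
  x-y≡0⇒x≡y x y e = ≈⇒≡ (RP.x∙y⁻¹≈ε⇒x≈y x y (≡⇒≈ e))

  x-y+y≡x : ∀ x y → (x - y) + y ≡ x
  x-y+y≡x x y = ≈⇒≡ (RP.//-rightDividesˡ y x)

  x-0≡x : ∀ x {y} → y ≡ 0# → x - y ≡ x
  x-0≡x x refl = trans (cong (x +_) -0#≡0#) (+-identityʳ x)

  ∑ : ∀ {A : Set} → List A → (A → Carrier) → Carrier
  ∑ xs f = sumL (L.map f xs)

  ∑-cong : ∀ {A : Set} (xs : List A) {f g : A → Carrier} → (∀ x → f x ≡ g x) → ∑ xs f ≡ ∑ xs g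
  ∑-cong []       f≗g = refl
  ∑-cong (x ∷ xs) f≗g = cong₂ _+_ (f≗g x) (∑-cong xs f≗g)

  ∑-zero : ∀ {A : Set} {xs : List A} {f : A → Carrier} → All (λ x → f x ≡ 0#) xs → ∑ xs f ≡ 0#
  ∑-zero []           = refl
  ∑-zero (fx≡0 ∷ all) = trans (cong₂ _+_ fx≡0 (∑-zero all)) (+-identityˡ 0#)

  ∑-+ : ∀ {A : Set} (xs : List A) (f g : A → Carrier) → ∑ xs (λ x → f x + g x) ≡ ∑ xs f + ∑ xs g
  ∑-+ []       f g = sym (+-identityˡ 0#)
  ∑-+ (x ∷ xs) f g = trans (cong (f x + g x +_) (∑-+ xs f g)) (+-interchange (f x) (g x) _ _)

  ∑-*ˡ : ∀ {A : Set} (xs : List A) (a : Carrier) (f : A → Carrier) → ∑ xs (λ x → a * f x) ≡ a * ∑ xs f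
  ∑-*ˡ []       a f = sym (*-zeroʳ a)
  ∑-*ˡ (x ∷ xs) a f = trans (cong (a * f x +_) (∑-*ˡ xs a f)) (sym (*-distribˡ-+ a (f x) _))

  ∑-*ʳ : ∀ {A : Set} (xs : List A) (a : Carrier) (f : A → Carrier) → ∑ xs (λ x → f x * a) ≡ ∑ xs f * a
  ∑-*ʳ []       a f = sym (*-zeroˡ a)
  ∑-*ʳ (x ∷ xs) a f = trans (cong (f x * a +_) (∑-*ʳ xs a f)) (sym (*-distribʳ-+ a (f x) _))

  ∑-neg : ∀ {A : Set} (xs : List A) (f : A → Carrier) → ∑ xs (λ x → - f x) ≡ - ∑ xs f
  ∑-neg []       f = sym -0#≡0#
  ∑-neg (x ∷ xs) f = trans (cong (- f x +_) (∑-neg xs f)) (-‿+-comm (f x) _)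

  ∑-++ : ∀ {A : Set} (xs ys : List A) (f : A → Carrier) → ∑ (xs L.++ ys) f ≡ ∑ xs f + ∑ ys f
  ∑-++ []       ys f = sym (+-identityˡ _)
  ∑-++ (x ∷ xs) ys f = trans (cong (f x +_) (∑-++ xs ys f)) (sym (+-assoc (f x) _ _))

  ∑-map : ∀ {A B : Set} (g : A → B) (xs : List A) (f : B → Carrier) → ∑ (L.map g xs) f ≡ ∑ xs (λ x → f (g x))
  ∑-map g []       f = refl
  ∑-map g (x ∷ xs) f = cong (f (g x) +_) (∑-map g xs f)

  ∑-concatMap : ∀ {A B : Set} (g : A → List B) (xs : List A) (f : B → Carrier) →
    ∑ (L.concatMap g xs) f ≡ ∑ xs (λ x → ∑ (g x) f)
  ∑-concatMap g []       f = refl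
  ∑-concatMap g (x ∷ xs) f = trans (∑-++ (g x) (L.concatMap g xs) f) (cong (∑ (g x) f +_) (∑-concatMap g xs f))

  ∑-comm : ∀ {A B : Set} (xs : List A) (ys : List B) (h : A → B → Carrier) →
    ∑ xs (λ x → ∑ ys (h x)) ≡ ∑ ys (λ y → ∑ xs (λ x → h x y))
  ∑-comm []       ys h = sym (∑-zero (All.universal (λ _ → refl) ys))
  ∑-comm (x ∷ xs) ys h = trans (cong (∑ ys (h x) +_) (∑-comm xs ys h)) (sym (∑-+ ys (h x) _))

  ∑-single : ∀ {A : Set} {xs : List A} {f : A → Carrier} {a : A} → Unique xs → a ∈ xs →
    (∀ x → x ≢ a → f x ≡ 0#) → ∑ xs f ≡ f a
  ∑-single {f = f} (a∉xs ∷ _) (here refl) f≡0 =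
    trans (cong (f _ +_) (∑-zero (All.map (λ a≢x → f≡0 _ (λ x≡a → a≢x (sym x≡a))) a∉xs))) (+-identityʳ _)
  ∑-single {f = f} (x∉xs ∷ xs-unique) (there a∈xs) f≡0 =
    trans (cong₂ _+_ (f≡0 _ (All.lookup x∉xs a∈xs)) (∑-single xs-unique a∈xs f≡0)) (+-identityˡ _)

  lookup-injective : ∀ {A : Set} {xs : List A} → Unique xs → ∀ i j → L.lookup xs i ≡ L.lookup xs j → i ≡ j
  lookup-injective (_ ∷ _)          zero    zero    _ = refl
  lookup-injective (x∉xs ∷ _)        zero    (suc j) e = ⊥-elim (All.lookup x∉xs (∈.∈-lookup j) e)
  lookup-injective (x∉xs ∷ _)        (suc i) zero    e = ⊥-elim (All.lookup x∉xs (∈.∈-lookup i) (sym e))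
  lookup-injective (_ ∷ xs-unique)   (suc i) (suc j) e = cong suc (lookup-injective xs-unique i j e)

  private
    module Enum = Inverse enum

  _≟_ : (x y : Carrier) → Dec (x ≡ y)
  _≟_ = via-injection (↔⇒↣ enum) Fin._≟_

  _≟ᵛ_ : ∀ {r} (c d : Pt r) → Dec (c ≡ d)
  _≟ᵛ_ = V.≡-dec _≟_

  ∈-elems : ∀ x → x ∈ elems
  ∈-elems x = subst (_∈ elems) (Enum.strictlyInverseʳ x) (∈.∈-map⁺ Enum.from (∈.∈-allFin (Enum.to x)))

  elems-unique : Unique elems
  elems-unique = Unique.map⁺ (λ {a} {b} e → trans (sym (Enum.strictlyInverseˡ a))
                                               (trans (cong Enum.to e) (Enum.strictlyInverseˡ b)))
                             (Unique.allFin⁺ q)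

  concatMap-map≡cartesianProductWith : ∀ {A B C : Set} (f : A → B → C) (xs : List A) (ys : List B) →
    L.concatMap (λ x → L.map (f x) ys) xs ≡ L.cartesianProductWith f xs ys
  concatMap-map≡cartesianProductWith f []       ys = refl
  concatMap-map≡cartesianProductWith f (x ∷ xs) ys =
    cong (L.map (f x) ys L.++_) (concatMap-map≡cartesianProductWith f xs ys)

  ∈-allPts : ∀ r (c : Pt r) → c ∈ allPts r
  ∈-allPts ℕ.zero    []      = here refl
  ∈-allPts (ℕ.suc r) (x ∷ c) = subst ((x ∷ c) ∈_) (sym (concatMap-map≡cartesianProductWith _∷_ elems (allPts r)))
    (∈.∈-cartesianProductWith⁺ _∷_ (∈-elems x) (∈-allPts r c))

  allPts-unique : ∀ r → Unique (allPts r)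
  allPts-unique ℕ.zero    = [] ∷ []
  allPts-unique (ℕ.suc r) = subst Unique (sym (concatMap-map≡cartesianProductWith _∷_ elems (allPts r)))
    (Unique.cartesianProductWith⁺ _∷_ V.∷-injective elems-unique (allPts-unique r))

  opaque
    e : ∀ {r} → Pt r → Word r
    e c d with d ≟ᵛ c
    ... | yes _ = 1#
    ... | no  _ = 0#

    e-diag : ∀ {r} (c : Pt r) → e c c ≡ 1#
    e-diag c with c ≟ᵛ c
    ... | yes _   = refl
    ... | no  c≢c = ⊥-elim (c≢c refl)

    e-off : ∀ {r} (c d : Pt r) → d ≢ c → e c d ≡ 0#
    e-off c d d≢c with d ≟ᵛ c
    ... | yes d≡c = ⊥-elim (d≢c d≡c)
    ... | no  _   = refl

  Σpts-cong : ∀ r {f g : Word r} → (∀ c → f c ≡ g c) → Σpts r f ≡ Σpts r g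
  Σpts-cong r = ∑-cong (allPts r)

  Σpts-zero : ∀ r {f : Word r} → (∀ c → f c ≡ 0#) → Σpts r f ≡ 0#
  Σpts-zero r f≡0 = ∑-zero (All.universal f≡0 (allPts r))

  Σpts-single : ∀ r (f : Word r) (c : Pt r) → (∀ d → d ≢ c → f d ≡ 0#) → Σpts r f ≡ f c
  Σpts-single r f c = ∑-single (allPts-unique r) (∈-allPts r c)

  Σpts-e : ∀ r (c : Pt r) → Σpts r (e c) ≡ 1#
  Σpts-e r c = trans (Σpts-single r (e c) c (e-off c)) (e-diag c)

  e-e₀ : ∀ {r} → Pt r → Word r
  e-e₀ {r} c x = e c x - e (zeroPt r) x

  Σpts-e-e₀ : ∀ r (c : Pt r) → Σpts r (e-e₀ c) ≡ 0#
  Σpts-e-e₀ r c = begin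
    Σpts r (e-e₀ c)                                ≡⟨ ∑-+ (allPts r) (e c) _ ⟩
    Σpts r (e c) + Σpts r (λ x → - e (zeroPt r) x) ≡⟨ cong (Σpts r (e c) +_) (∑-neg (allPts r) (e (zeroPt r))) ⟩
    Σpts r (e c) - Σpts r (e (zeroPt r))           ≡⟨ x≡y⇒x-y≡0 (trans (Σpts-e r c) (sym (Σpts-e r (zeroPt r)))) ⟩
    0#                                             ∎

  Σpts-e-* : ∀ r (c : Pt r) (f : Word r) → Σpts r (λ d → e c d * f d) ≡ f c
  Σpts-e-* r c f = begin
    Σpts r (λ d → e c d * f d) ≡⟨ Σpts-single r _ c (λ d d≢c → trans (cong (_* f d) (e-off c d d≢c)) (*-zeroˡ _)) ⟩
    e c c * f c                ≡⟨ cong (_* f c) (e-diag c) ⟩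
    1# * f c                   ≡⟨ *-identityˡ (f c) ⟩
    f c                        ∎

  Σpts-suc : ∀ r (f : Word (ℕ.suc r)) → Σpts (ℕ.suc r) f ≡ ∑ elems (λ x → Σpts r (λ c → f (x ∷ c)))
  Σpts-suc r f = trans (∑-concatMap (λ x → L.map (x ∷_) (allPts r)) elems f)
                       (∑-cong elems (λ x → ∑-map (x ∷_) (allPts r) f))

  Σpts-++ : ∀ r₁ r₂ (f : Word (r₁ ℕ.+ r₂)) →
    Σpts (r₁ ℕ.+ r₂) f ≡ Σpts r₁ (λ x → Σpts r₂ (λ y → f (x ++ y)))
  Σpts-++ ℕ.zero     r₂ f = sym (+-identityʳ _)
  Σpts-++ (ℕ.suc r₁) r₂ f = begin
    Σpts (ℕ.suc r₁ ℕ.+ r₂) f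
      ≡⟨ Σpts-suc (r₁ ℕ.+ r₂) f ⟩
    ∑ elems (λ x → Σpts (r₁ ℕ.+ r₂) (λ c → f (x ∷ c)))
      ≡⟨ ∑-cong elems (λ x → Σpts-++ r₁ r₂ (λ c → f (x ∷ c))) ⟩
    ∑ elems (λ x → Σpts r₁ (λ a → Σpts r₂ (λ y → f ((x ∷ a) ++ y))))
      ≡⟨ Σpts-suc r₁ (λ a → Σpts r₂ (λ y → f (a ++ y))) ⟨
    Σpts (ℕ.suc r₁) (λ x → Σpts r₂ (λ y → f (x ++ y))) ∎

  Σpts-comm : ∀ r r′ (h : Pt r → Pt r′ → Carrier) →
    Σpts r (λ x → Σpts r′ (h x)) ≡ Σpts r′ (λ y → Σpts r (λ x → h x y))
  Σpts-comm r r′ = ∑-comm (allPts r) (allPts r′)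

  -- Write f (σ c) as Σ_d e_(σ c)(d) f d and swap the two sums.
  Σpts-permute : ∀ r (σ : Perm r) (f : Word r) → Σpts r (λ c → f (Inverse.to σ c)) ≡ Σpts r f
  Σpts-permute r σ f = begin
    Σpts r (λ c → f (to c))                        ≡⟨ Σpts-cong r (λ c → Σpts-e-* r (to c) f) ⟨
    Σpts r (λ c → Σpts r (λ d → e (to c) d * f d)) ≡⟨ Σpts-comm r r _ ⟩
    Σpts r (λ d → Σpts r (λ c → e (to c) d * f d)) ≡⟨ Σpts-cong r (λ d → ∑-*ʳ (allPts r) (f d) _) ⟩
    Σpts r (λ d → Σpts r (λ c → e (to c) d) * f d) ≡⟨ Σpts-cong r (λ d → cong (_* f d) (one-preimage d)) ⟩
    Σpts r (λ d → 1# * f d)                        ≡⟨ Σpts-cong r (λ d → *-identityˡ (f d)) ⟩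
    Σpts r f                                       ∎
    where
      open Inverse σ
      one-preimage : ∀ d → Σpts r (λ c → e (to c) d) ≡ 1#
      one-preimage d = begin
        Σpts r (λ c → e (to c) d) ≡⟨ Σpts-single r _ (from d) (λ c c≢from-d → e-off (to c) d (λ d≡to-c →
                                       c≢from-d (trans (sym (strictlyInverseʳ c)) (cong from (sym d≡to-c))))) ⟩
        e (to (from d)) d         ≡⟨ cong (λ c → e c d) (strictlyInverseˡ d) ⟩
        e d d                     ≡⟨ e-diag d ⟩
        1#                        ∎

  -- Linear combinations, linear maps and dimension

  comb-++ : ∀ {r k t} (α : Vec Carrier k) (β : Vec Carrier t) (us : Vec (Word r) k) (vs : Vec (Word r) t) c →
    comb (α ++ β) (us ++ vs) c ≡ comb α us c + comb β vs c
  comb-++ []      β []       vs c = sym (+-identityˡ _)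
  comb-++ (a ∷ α) β (u ∷ us) vs c = trans (cong (a * u c +_) (comb-++ α β us vs c)) (sym (+-assoc _ _ _))

  comb-zeroˡ : ∀ {r d} (as : Vec Carrier d) (bs : Vec (Word r) d) c → (∀ i → lookup as i ≡ 0#) → comb as bs c ≡ 0#
  comb-zeroˡ []       []       c as≡0 = refl
  comb-zeroˡ (a ∷ as) (b ∷ bs) c as≡0 =
    trans (cong₂ _+_ (trans (cong (_* b c) (as≡0 zero)) (*-zeroˡ _)) (comb-zeroˡ as bs c (λ i → as≡0 (suc i))))
          (+-identityˡ 0#)

  comb-zeroʳ : ∀ {r d} (as : Vec Carrier d) (bs : Vec (Word r) d) c → (∀ i → lookup bs i c ≡ 0#) → comb as bs c ≡ 0#
  comb-zeroʳ []       []       c bs≡0 = refl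
  comb-zeroʳ (a ∷ as) (b ∷ bs) c bs≡0 =
    trans (cong₂ _+_ (trans (cong (a *_) (bs≡0 zero)) (*-zeroʳ _)) (comb-zeroʳ as bs c (λ i → bs≡0 (suc i))))
          (+-identityˡ 0#)

  comb-cong : ∀ {r r′ d} (as : Vec Carrier d) (bs : Vec (Word r) d) (bs′ : Vec (Word r′) d) c c′ →
    (∀ i → lookup bs i c ≡ lookup bs′ i c′) → comb as bs c ≡ comb as bs′ c′
  comb-cong []       []       []         c c′ bs≗bs′ = refl
  comb-cong (a ∷ as) (b ∷ bs) (b′ ∷ bs′) c c′ bs≗bs′ =
    cong₂ _+_ (cong (a *_) (bs≗bs′ zero)) (comb-cong as bs bs′ c c′ (λ i → bs≗bs′ (suc i)))

  comb-dual : ∀ {r d} (as : Vec Carrier d) (bs : Vec (Word r) d) c (j : Fin d) →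
    lookup bs j c ≡ 1# → (∀ i → i ≢ j → lookup bs i c ≡ 0#) → comb as bs c ≡ lookup as j
  comb-dual (a ∷ as) (b ∷ bs) c zero    b≡1 bs≡0 =
    trans (cong₂ _+_ (trans (cong (a *_) b≡1) (*-identityʳ a)) (comb-zeroʳ as bs c (λ i → bs≡0 (suc i) (λ ()))))
          (+-identityʳ a)
  comb-dual (a ∷ as) (b ∷ bs) c (suc j) b≡1 bs≡0 =
    trans (cong₂ _+_ (trans (cong (a *_) (bs≡0 zero (λ ()))) (*-zeroʳ a))
                     (comb-dual as bs c j b≡1 (λ i i≢j → bs≡0 (suc i) (λ e → i≢j (Fin.suc-injective e)))))
          (+-identityˡ _)

  record LinearMap (r r′ : ℕ) : Set where
    field
      app      : Word r → Word r′
      app-cong : ∀ {u v : Word r} → (∀ c → u c ≡ v c) → ∀ d → app u d ≡ app v d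
      +-homo   : ∀ (u v : Word r) d → app (λ c → u c + v c) d ≡ app u d + app v d
      *-homo   : ∀ a (u : Word r) d → app (λ c → a * u c) d ≡ a * app u d

    0-homo : ∀ d → app (λ _ → 0#) d ≡ 0#
    0-homo d = trans (app-cong (λ _ → sym (*-zeroˡ 0#)) d) (trans (*-homo 0# (λ _ → 0#) d) (*-zeroˡ _))

    sub-homo : ∀ (u v : Word r) d → app (λ c → u c - v c) d ≡ app u d - app v d
    sub-homo u v d = begin
      app (λ c → u c - v c) d            ≡⟨ app-cong (λ c → cong (u c +_) (sym (-1*x≡-x (v c)))) d ⟩
      app (λ c → u c + - 1# * v c) d     ≡⟨ +-homo u _ d ⟩
      app u d + app (λ c → - 1# * v c) d ≡⟨ cong (app u d +_) (trans (*-homo (- 1#) v d) (-1*x≡-x _)) ⟩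
      app u d - app v d                  ∎

    comb-homo : ∀ {k} (as : Vec Carrier k) (bs : Vec (Word r) k) d → app (comb as bs) d ≡ comb as (V.map app bs) d
    comb-homo []       []       d = 0-homo d
    comb-homo (a ∷ as) (b ∷ bs) d =
      trans (+-homo (λ c → a * b c) (comb as bs) d) (cong₂ _+_ (*-homo a b d) (comb-homo as bs d))

  open LinearMap

  HasDim-cong : ∀ {r d} {S S′ : Word r → Set} → (∀ z → S z → S′ z) → (∀ z → S′ z → S z) →
    HasDim r S d → HasDim r S′ d
  HasDim-cong S⊆S′ S′⊆S (bs , bs∈S , independent , spans) =
    bs , (λ i → S⊆S′ _ (bs∈S i)) , independent , (λ y y∈S′ → spans y (S′⊆S y y∈S′))

  lookup-++⁺ : ∀ {A : Set} {m n} (P : A → Set) (xs : Vec A m) (ys : Vec A n) →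
    (∀ i → P (lookup xs i)) → (∀ j → P (lookup ys j)) → ∀ i → P (lookup (xs ++ ys) i)
  lookup-++⁺ P xs ys Pxs Pys =
    VecAll.lookup⁺ {P = P} (VecAll.++⁺ (VecAll.lookup⁻ {xs = xs} Pxs) (VecAll.lookup⁻ {xs = ys} Pys))

  -- If M : S → T has a right inverse L and S = K ⊕ L(T) with K = ker M, then dim S = dim K + dim T.
  HasDim-split : ∀ {r r′ k t} {S K : Word r → Set} {T : Word r′ → Set} (M : LinearMap r r′) (L : LinearMap r′ r) →
    HasDim r K k → HasDim r′ T t →
    (∀ z → K z → S z) → (∀ u → T u → S (app L u)) → (∀ z → S z → T (app M z)) →
    (∀ z → K z → ∀ x → app M z x ≡ 0#) → (∀ u → T u → ∀ x → app M (app L u) x ≡ u x) →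
    (∀ z → S z → K (λ c → z c - app L (app M z) c)) →
    HasDim r S (k ℕ.+ t)
  HasDim-split {r} {k = k} {t = t} {S} M L (ks , ks∈K , ks-independent , ks-span) (ts , ts∈T , ts-independent , ts-span)
               K⊆S L[T]⊆S M[S]⊆T M[K]≡0 M∘L≡id z-LMz∈K = ks ++ ls , basis∈S , independent , spans
    where
      ls : Vec (Word r) t
      ls = V.map (app L) ts

      M-comb-ks : ∀ α x → app M (comb α ks) x ≡ 0#
      M-comb-ks α x = trans (comb-homo M α ks x) (comb-zeroʳ α _ x (λ i →
        trans (cong (λ w → w x) (V.lookup-map i (app M) ks)) (M[K]≡0 _ (ks∈K i) x)))

      M-comb-ls : ∀ β x → app M (comb β ls) x ≡ comb β ts x
      M-comb-ls β x = trans (comb-homo M β ls x) (comb-cong β _ ts x x (λ j → begin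
        lookup (V.map (app M) ls) j x ≡⟨ cong (λ w → w x) (V.lookup-map j (app M) ls) ⟩
        app M (lookup ls j) x         ≡⟨ cong (λ w → app M w x) (V.lookup-map j (app L) ts) ⟩
        app M (app L (lookup ts j)) x ≡⟨ M∘L≡id _ (ts∈T j) x ⟩
        lookup ts j x                 ∎))

      independent-++ : ∀ α β → (∀ c → comb α ks c + comb β ls c ≡ 0#) →
        (∀ i → lookup α i ≡ 0#) × (∀ j → lookup β j ≡ 0#)
      independent-++ α β sum≡0 = α≡0 , β≡0
        where
          comb-ts≡0 : ∀ x → comb β ts x ≡ 0#
          comb-ts≡0 x = begin
            comb β ts x                                  ≡⟨ M-comb-ls β x ⟨
            app M (comb β ls) x                          ≡⟨ +-identityˡ _ ⟨
            0# + app M (comb β ls) x                     ≡⟨ cong (_+ app M (comb β ls) x) (M-comb-ks α x) ⟨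
            app M (comb α ks) x + app M (comb β ls) x    ≡⟨ +-homo M (comb α ks) (comb β ls) x ⟨
            app M (λ c → comb α ks c + comb β ls c) x    ≡⟨ app-cong M sum≡0 x ⟩
            app M (λ _ → 0#) x                           ≡⟨ 0-homo M x ⟩
            0#                                           ∎
          β≡0 : ∀ j → lookup β j ≡ 0#
          β≡0 j = ≈⇒≡ (ts-independent β (λ x → ≡⇒≈ (comb-ts≡0 x)) j)
          comb-ks≡0 : ∀ c → comb α ks c ≡ 0#
          comb-ks≡0 c = trans (sym (+-identityʳ _)) (trans (cong (comb α ks c +_) (sym (comb-zeroˡ β ls c β≡0))) (sum≡0 c))
          α≡0 : ∀ i → lookup α i ≡ 0#
          α≡0 i = ≈⇒≡ (ks-independent α (λ c → ≡⇒≈ (comb-ks≡0 c)) i)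

      basis∈S : ∀ i → S (lookup (ks ++ ls) i)
      basis∈S = lookup-++⁺ S ks ls (λ i → K⊆S _ (ks∈K i))
                             (λ j → subst S (sym (V.lookup-map j (app L) ts)) (L[T]⊆S _ (ts∈T j)))

      independent : LinIndep (ks ++ ls)
      independent γ γ≡0 i with V.splitAt k γ
      ... | α , β , refl =
        let α≡0 , β≡0 = independent-++ α β (λ c → trans (sym (comb-++ α β ks ls c)) (≈⇒≡ (γ≡0 c)))
        in ≡⇒≈ (lookup-++⁺ (_≡ 0#) α β α≡0 β≡0 i)

      spans : Spans S (ks ++ ls)
      spans z z∈S with ts-span (app M z) (M[S]⊆T z z∈S) | ks-span _ (z-LMz∈K z z∈S)
      ... | β , Mz≡β·ts | α , z-LMz≡α·ks = α ++ β , λ c → ≡⇒≈ (begin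
        z c                                           ≡⟨ x-y+y≡x (z c) (app L (app M z) c) ⟨
        (z c - app L (app M z) c) + app L (app M z) c ≡⟨ cong₂ _+_ (≈⇒≡ (z-LMz≡α·ks c))
                                                           (trans (app-cong L (λ x → ≈⇒≡ (Mz≡β·ts x)) c) (comb-homo L β ts c)) ⟩
        comb α ks c + comb β ls c                     ≡⟨ comb-++ α β ks ls c ⟨
        comb (α ++ β) (ks ++ ls) c                    ∎)

  fibreSum : ∀ {r r′ s} (h : Pt r′ → Pt s → Pt r) → LinearMap r r′
  fibreSum {s = s} h = record
    { app      = λ z x → Σpts s (λ y → z (h x y))
    ; app-cong = λ u≗v x → Σpts-cong s (λ y → u≗v (h x y))
    ; +-homo   = λ u v x → ∑-+ (allPts s) _ _
    ; *-homo   = λ a u x → ∑-*ˡ (allPts s) a _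
    }

  Null : ∀ {r} → Word r → Set
  Null u = ∀ c → u c ≡ 0#

  record ZeroSum (r : ℕ) (P : Word r → Set) : Set where
    field
      resp     : ∀ {u v : Word r} → (∀ c → u c ≡ v c) → P u → P v
      has-zero : P (λ _ → 0#)
      sum≡0    : ∀ u → P u → Σpts r u ≡ 0#

  open ZeroSum

  D-resp : ∀ r {u v : Word r} → (∀ c → u c ≡ v c) → D r u → D r v
  D-resp r u≗v (Σu≈0 , momentsu≈0) =
    ≡⇒≈ (trans (sym (Σpts-cong r u≗v)) (≈⇒≡ Σu≈0)) ,
    λ i → ≡⇒≈ (trans (sym (Σpts-cong r (λ c → cong (_* lookup c i) (u≗v c)))) (≈⇒≡ (momentsu≈0 i)))

  D-zero : ∀ r → D r (λ _ → 0#)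
  D-zero r = ≡⇒≈ (Σpts-zero r (λ _ → refl)) , λ i → ≡⇒≈ (Σpts-zero r (λ c → *-zeroˡ _))

  D-ZeroSum : ∀ r → ZeroSum r (D r)
  D-ZeroSum r = record { resp = D-resp r ; has-zero = D-zero r ; sum≡0 = λ u u∈D → ≈⇒≡ (proj₁ u∈D) }

  Image-D⇒ : ∀ r (τ : Perm r) u → Image τ (D r) u → D r (λ c → u (Inverse.to τ c))
  Image-D⇒ r τ u (y , y∈D , u≈τy) =
    D-resp r (λ c → sym (trans (≈⇒≡ (u≈τy (Inverse.to τ c))) (cong y (Inverse.strictlyInverseʳ τ c)))) y∈D

  Image-D⇐ : ∀ r (τ : Perm r) u → D r (λ c → u (Inverse.to τ c)) → Image τ (D r) u
  Image-D⇐ r τ u u∘τ∈D =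
    (λ c → u (Inverse.to τ c)) , u∘τ∈D , λ d → ≡⇒≈ (cong u (sym (Inverse.strictlyInverseˡ τ d)))

  D∩Image-ZeroSum : ∀ r (τ : Perm r) → ZeroSum r (D r ∩ Image τ (D r))
  D∩Image-ZeroSum r τ = record
    { resp     = λ u≗v (u∈D , u∈τD) →
        D-resp r u≗v u∈D , Image-D⇐ r τ _ (D-resp r (λ c → u≗v (Inverse.to τ c)) (Image-D⇒ r τ _ u∈τD))
    ; has-zero = D-zero r , Image-D⇐ r τ _ (D-zero r)
    ; sum≡0    = λ u u∈D∩τD → ≈⇒≡ (proj₁ (proj₁ u∈D∩τD))
    }

  -- Words on F_q^(r₁+r₂) and their two marginals

  module Blocks (r₁ r₂ : ℕ) where

    R : ℕ
    R = r₁ ℕ.+ r₂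

    0₁ : Pt r₁
    0₁ = zeroPt r₁

    0₂ : Pt r₂
    0₂ = zeroPt r₂

    _⊗_ : Word r₁ → Word r₂ → Word R
    (u ⊗ v) c = u (take r₁ c) * v (drop r₁ c)

    ⊗-++ : ∀ u v x y → (u ⊗ v) (x ++ y) ≡ u x * v y
    ⊗-++ u v x y = cong₂ _*_ (cong u (take-++ r₁ x y)) (cong v (drop-++ r₁ x y))

    marginal₁ : LinearMap R r₁
    marginal₁ = fibreSum (λ x y → x ++ y)

    marginal₂ : LinearMap R r₂
    marginal₂ = fibreSum (λ y x → x ++ y)

    marginal₁-⊗ : ∀ u v x → app marginal₁ (u ⊗ v) x ≡ u x * Σpts r₂ v
    marginal₁-⊗ u v x = trans (Σpts-cong r₂ (⊗-++ u v x)) (∑-*ˡ (allPts r₂) (u x) v)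

    marginal₂-⊗ : ∀ u v y → app marginal₂ (u ⊗ v) y ≡ Σpts r₁ u * v y
    marginal₂-⊗ u v y = trans (Σpts-cong r₁ (λ x → ⊗-++ u v x y)) (∑-*ʳ (allPts r₁) (v y) u)

    inject₁ : LinearMap r₁ R
    inject₁ = record
      { app      = λ u → u ⊗ e 0₂
      ; app-cong = λ u≗v c → cong (_* _) (u≗v _)
      ; +-homo   = λ u v c → *-distribʳ-+ _ _ _
      ; *-homo   = λ a u c → *-assoc _ _ _
      }

    inject₂ : LinearMap r₂ R
    inject₂ = record
      { app      = λ v → e 0₁ ⊗ v
      ; app-cong = λ u≗v c → cong (_ *_) (u≗v _)
      ; +-homo   = λ u v c → *-distribˡ-+ _ _ _
      ; *-homo   = λ a u c → trans (sym (*-assoc _ _ _)) (trans (cong (_* _) (*-comm _ a)) (*-assoc _ _ _))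
      }

    marginal₁-inject₁ : ∀ u x → app marginal₁ (app inject₁ u) x ≡ u x
    marginal₁-inject₁ u x = trans (marginal₁-⊗ u (e 0₂) x) (trans (cong (u x *_) (Σpts-e r₂ 0₂)) (*-identityʳ _))

    marginal₂-inject₁ : ∀ u y → Σpts r₁ u ≡ 0# → app marginal₂ (app inject₁ u) y ≡ 0#
    marginal₂-inject₁ u y Σu≡0 = trans (marginal₂-⊗ u (e 0₂) y) (trans (cong (_* _) Σu≡0) (*-zeroˡ _))

    marginal₁-inject₂ : ∀ v x → Σpts r₂ v ≡ 0# → app marginal₁ (app inject₂ v) x ≡ 0#
    marginal₁-inject₂ v x Σv≡0 = trans (marginal₁-⊗ (e 0₁) v x) (trans (cong (_ *_) Σv≡0) (*-zeroʳ _))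

    marginal₂-inject₂ : ∀ v y → app marginal₂ (app inject₂ v) y ≡ v y
    marginal₂-inject₂ v y = trans (marginal₂-⊗ (e 0₁) v y) (trans (cong (_* v y) (Σpts-e r₁ 0₁)) (*-identityˡ _))

    Marginals : (Word r₁ → Set) → (Word r₂ → Set) → Word R → Set
    Marginals P₁ P₂ z = P₁ (app marginal₁ z) × P₂ (app marginal₂ z)

    Marginals-Null-dim : ∀ {k d₂} {P₂ : Word r₂ → Set} → ZeroSum r₂ P₂ →
      HasDim R (Marginals Null Null) k → HasDim r₂ P₂ d₂ → HasDim R (Marginals Null P₂) (k ℕ.+ d₂)
    Marginals-Null-dim {P₂ = P₂} P₂-zs K-dim P₂-dim =
      HasDim-split marginal₂ inject₂ K-dim P₂-dim
        (λ z (M₁z≡0 , M₂z≡0) → M₁z≡0 , resp P₂-zs (λ y → sym (M₂z≡0 y)) (has-zero P₂-zs))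
        (λ v v∈P₂ → (λ x → marginal₁-inject₂ v x (sum≡0 P₂-zs v v∈P₂)) ,
                    resp P₂-zs (λ y → sym (marginal₂-inject₂ v y)) v∈P₂)
        (λ _ → proj₂)
        (λ _ → proj₂)
        (λ v _ → marginal₂-inject₂ v)
        residual∈K
      where
        residual∈K : ∀ z → Marginals Null P₂ z →
          Marginals Null Null (λ c → z c - app inject₂ (app marginal₂ z) c)
        residual∈K z (M₁z≡0 , M₂z∈P₂) = M₁≡0 , M₂≡0
          where
            M₂z = app marginal₂ z
            M₁≡0 : Null (app marginal₁ (λ c → z c - app inject₂ M₂z c))
            M₁≡0 x = begin
              app marginal₁ (λ c → z c - app inject₂ M₂z c) x          ≡⟨ sub-homo marginal₁ z (app inject₂ M₂z) x ⟩
              app marginal₁ z x - app marginal₁ (app inject₂ M₂z) x   ≡⟨ cong (_- app marginal₁ (app inject₂ M₂z) x) (M₁z≡0 x) ⟩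
              0# - app marginal₁ (app inject₂ M₂z) x                  ≡⟨ x-0≡x 0# (marginal₁-inject₂ M₂z x (sum≡0 P₂-zs M₂z M₂z∈P₂)) ⟩
              0#                                                      ∎
            M₂≡0 : Null (app marginal₂ (λ c → z c - app inject₂ M₂z c))
            M₂≡0 y = trans (sub-homo marginal₂ z (app inject₂ M₂z) y) (x≡y⇒x-y≡0 (sym (marginal₂-inject₂ M₂z y)))

    Marginals-dim : ∀ {k d₁ d₂} {P₁ : Word r₁ → Set} {P₂ : Word r₂ → Set} → ZeroSum r₁ P₁ → ZeroSum r₂ P₂ →
      HasDim R (Marginals Null Null) k → HasDim r₁ P₁ d₁ → HasDim r₂ P₂ d₂ →
      HasDim R (Marginals P₁ P₂) ((k ℕ.+ d₂) ℕ.+ d₁)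
    Marginals-dim {P₁ = P₁} {P₂} P₁-zs P₂-zs K-dim P₁-dim P₂-dim =
      HasDim-split marginal₁ inject₁ (Marginals-Null-dim P₂-zs K-dim P₂-dim) P₁-dim
        (λ z (M₁z≡0 , M₂z∈P₂) → resp P₁-zs (λ x → sym (M₁z≡0 x)) (has-zero P₁-zs) , M₂z∈P₂)
        (λ u u∈P₁ → resp P₁-zs (λ x → sym (marginal₁-inject₁ u x)) u∈P₁ ,
                    resp P₂-zs (λ y → sym (marginal₂-inject₁ u y (sum≡0 P₁-zs u u∈P₁))) (has-zero P₂-zs))
        (λ _ → proj₁)
        (λ _ → proj₁)
        (λ u _ → marginal₁-inject₁ u)
        residual∈K
      where
        residual∈K : ∀ z → Marginals P₁ P₂ z →
          Marginals Null P₂ (λ c → z c - app inject₁ (app marginal₁ z) c)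
        residual∈K z (M₁z∈P₁ , M₂z∈P₂) = M₁≡0 , resp P₂-zs M₂-unchanged M₂z∈P₂
          where
            M₁z = app marginal₁ z
            M₁≡0 : Null (app marginal₁ (λ c → z c - app inject₁ M₁z c))
            M₁≡0 x = trans (sub-homo marginal₁ z (app inject₁ M₁z) x) (x≡y⇒x-y≡0 (sym (marginal₁-inject₁ M₁z x)))
            M₂-unchanged : ∀ y → app marginal₂ z y ≡ app marginal₂ (λ c → z c - app inject₁ M₁z c) y
            M₂-unchanged y = sym (trans (sub-homo marginal₂ z (app inject₁ M₁z) y)
                                   (x-0≡x (app marginal₂ z y) (marginal₂-inject₁ M₁z y (sum≡0 P₁-zs M₁z M₁z∈P₁))))

    split-≡ : ∀ {c d : Pt R} → take r₁ c ≡ take r₁ d → drop r₁ c ≡ drop r₁ d → c ≡ d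
    split-≡ {c} {d} take≡ drop≡ = trans (sym (take++drop r₁ c)) (trans (cong₂ _++_ take≡ drop≡) (take++drop r₁ d))

    e-⊗ : ∀ p c → (e (take r₁ p) ⊗ e (drop r₁ p)) c ≡ e p c
    e-⊗ p c with c ≟ᵛ p
    ... | yes refl = trans (cong₂ _*_ (e-diag _) (e-diag _)) (trans (*-identityˡ 1#) (sym (e-diag c)))
    ... | no c≢p with take r₁ c ≟ᵛ take r₁ p
    ...   | no take≢ = trans (cong (_* e (drop r₁ p) (drop r₁ c)) (e-off _ _ take≢))
                             (trans (*-zeroˡ _) (sym (e-off p c c≢p)))
    ...   | yes take≡ = trans (cong (e (take r₁ p) (take r₁ c) *_) (e-off _ _ (λ drop≡ → c≢p (split-≡ take≡ drop≡))))
                              (trans (*-zeroʳ _) (sym (e-off p c c≢p)))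

    OffAxes : Pt R → Set
    OffAxes c = (take r₁ c ≢ 0₁) × (drop r₁ c ≢ 0₂)

    offAxes? : ∀ c → Dec (OffAxes c)
    offAxes? c = ¬? (take r₁ c ≟ᵛ 0₁) ×-dec ¬? (drop r₁ c ≟ᵛ 0₂)

    Null-from-offAxes : ∀ w → Marginals Null Null w → (∀ c → OffAxes c → w c ≡ 0#) → Null w
    Null-from-offAxes w (M₁w≡0 , M₂w≡0) w≡0 c =
      subst (λ c → w c ≡ 0#) (take++drop r₁ c) (w-++ (take r₁ c) (drop r₁ c))
      where
        offAxes-++ : ∀ {x y} → x ≢ 0₁ → y ≢ 0₂ → OffAxes (x ++ y)
        offAxes-++ {x} {y} x≢0 y≢0 = (λ e → x≢0 (trans (sym (take-++ r₁ x y)) e)) ,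
                                     (λ e → y≢0 (trans (sym (drop-++ r₁ x y)) e))
        off-0₂ : ∀ x → x ≢ 0₁ → w (x ++ 0₂) ≡ 0#
        off-0₂ x x≢0 =
          trans (sym (Σpts-single r₂ (λ y → w (x ++ y)) 0₂ (λ y y≢0 → w≡0 _ (offAxes-++ x≢0 y≢0)))) (M₁w≡0 x)
        0₁-off : ∀ y → y ≢ 0₂ → w (0₁ ++ y) ≡ 0#
        0₁-off y y≢0 =
          trans (sym (Σpts-single r₁ (λ x → w (x ++ y)) 0₁ (λ x x≢0 → w≡0 _ (offAxes-++ x≢0 y≢0)))) (M₂w≡0 y)
        0₁-0₂ : w (0₁ ++ 0₂) ≡ 0#
        0₁-0₂ = trans (sym (Σpts-single r₂ (λ y → w (0₁ ++ y)) 0₂ 0₁-off)) (M₁w≡0 0₁)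
        w-++ : ∀ x y → w (x ++ y) ≡ 0#
        w-++ x y with x ≟ᵛ 0₁ | y ≟ᵛ 0₂
        ... | yes refl | yes refl = 0₁-0₂
        ... | yes refl | no y≢0   = 0₁-off y y≢0
        ... | no x≢0   | yes refl = off-0₂ x x≢0
        ... | no x≢0   | no y≢0   = w≡0 _ (offAxes-++ x≢0 y≢0)

    kernelWord : Pt R → Word R
    kernelWord p = e-e₀ (take r₁ p) ⊗ e-e₀ (drop r₁ p)

    kernelWord-∈ : ∀ p → Marginals Null Null (kernelWord p)
    kernelWord-∈ p =
      (λ x → trans (marginal₁-⊗ u v x) (trans (cong (u x *_) (Σpts-e-e₀ r₂ (drop r₁ p))) (*-zeroʳ _))) ,
      (λ y → trans (marginal₂-⊗ u v y) (trans (cong (_* v y) (Σpts-e-e₀ r₁ (take r₁ p))) (*-zeroˡ _)))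
      where
        u = e-e₀ (take r₁ p)
        v = e-e₀ (drop r₁ p)

    kernelWord-offAxes : ∀ p c → OffAxes c → kernelWord p c ≡ e p c
    kernelWord-offAxes p c (take≢0 , drop≢0) = trans
      (cong₂ _*_ (x-0≡x (e (take r₁ p) (take r₁ c)) (e-off 0₁ _ take≢0))
                 (x-0≡x (e (drop r₁ p) (drop r₁ c)) (e-off 0₂ _ drop≢0)))
      (e-⊗ p c)

    offAxisPts : List (Pt R)
    offAxisPts = L.filter offAxes? (allPts R)

    offAxisPt : Fin (L.length offAxisPts) → Pt R
    offAxisPt = L.lookup offAxisPts

    offAxisPt-offAxes : ∀ j → OffAxes (offAxisPt j)
    offAxisPt-offAxes j = proj₂ (∈.∈-filter⁻ offAxes? {xs = allPts R} (∈.∈-lookup j))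

    offAxisPt-complete : ∀ c → OffAxes c → ∃ λ j → offAxisPt j ≡ c
    offAxisPt-complete c c-off = Any.index c∈ , sym (Any.lookup-index c∈)
      where
        c∈ : c ∈ offAxisPts
        c∈ = ∈.∈-filter⁺ offAxes? (∈-allPts R c) c-off

    kernelBasis : Vec (Word R) (L.length offAxisPts)
    kernelBasis = V.tabulate (λ j → kernelWord (offAxisPt j))

    kernelBasis-∈ : ∀ i → Marginals Null Null (lookup kernelBasis i)
    kernelBasis-∈ i =
      subst (Marginals Null Null) (sym (V.lookup∘tabulate (λ j → kernelWord (offAxisPt j)) i)) (kernelWord-∈ (offAxisPt i))

    comb-kernelBasis : ∀ as j → comb as kernelBasis (offAxisPt j) ≡ lookup as j
    comb-kernelBasis as j = comb-dual as kernelBasis (offAxisPt j) j (trans (basis-at j j) (e-diag (offAxisPt j)))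
      (λ i i≢j → trans (basis-at i j) (e-off (offAxisPt i) (offAxisPt j)
         (λ pj≡pi → i≢j (lookup-injective (Unique.filter⁺ offAxes? (allPts-unique R)) i j (sym pj≡pi)))))
      where
        basis-at : ∀ i j → lookup kernelBasis i (offAxisPt j) ≡ e (offAxisPt i) (offAxisPt j)
        basis-at i j = trans (cong (λ w → w (offAxisPt j)) (V.lookup∘tabulate (λ j → kernelWord (offAxisPt j)) i))
                             (kernelWord-offAxes (offAxisPt i) (offAxisPt j) (offAxisPt-offAxes j))

    -- A word with null marginals is determined by its values off the axes, where kernelWord p is e_p.
    Marginals-Null-Null-dim : HasDim R (Marginals Null Null) (L.length offAxisPts)
    Marginals-Null-Null-dim = kernelBasis , kernelBasis-∈ , independent , spans
      where
        independent : LinIndep kernelBasis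
        independent as as·basis≡0 j = ≡⇒≈ (trans (sym (comb-kernelBasis as j)) (≈⇒≡ (as·basis≡0 (offAxisPt j))))

        comb-Null : ∀ {r′} (M : LinearMap R r′) → (∀ i → Null (app M (lookup kernelBasis i))) →
          ∀ as → Null (app M (comb as kernelBasis))
        comb-Null M M≡0 as x = trans (comb-homo M as kernelBasis x)
          (comb-zeroʳ as _ x (λ i → trans (cong (λ w → w x) (V.lookup-map i (app M) kernelBasis)) (M≡0 i x)))

        spans : Spans (Marginals Null Null) kernelBasis
        spans z (M₁z≡0 , M₂z≡0) = zs , λ c → ≡⇒≈ (x-y≡0⇒x≡y _ _ (Null-from-offAxes w w∈K w-offAxes c))
          where
            zs = V.tabulate (λ j → z (offAxisPt j))
            w : Word R
            w c = z c - comb zs kernelBasis c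
            w∈K : Marginals Null Null w
            w∈K = (λ x → trans (sub-homo marginal₁ z (comb zs kernelBasis) x)
                           (trans (x-0≡x _ (comb-Null marginal₁ (λ i → proj₁ (kernelBasis-∈ i)) zs x)) (M₁z≡0 x))) ,
                  (λ y → trans (sub-homo marginal₂ z (comb zs kernelBasis) y)
                           (trans (x-0≡x _ (comb-Null marginal₂ (λ i → proj₂ (kernelBasis-∈ i)) zs y)) (M₂z≡0 y)))
            w-offAxes : ∀ c → OffAxes c → w c ≡ 0#
            w-offAxes c c-off with offAxisPt-complete c c-off
            ... | j , refl = x≡y⇒x-y≡0 (sym (trans (comb-kernelBasis zs j) (V.lookup∘tabulate (λ j → z (offAxisPt j)) j)))

    Σpts-marginal₁ : ∀ z → Σpts R z ≡ Σpts r₁ (app marginal₁ z)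
    Σpts-marginal₁ z = Σpts-++ r₁ r₂ z

    Σpts-marginal₂ : ∀ z → Σpts R z ≡ Σpts r₂ (app marginal₂ z)
    Σpts-marginal₂ z = trans (Σpts-++ r₁ r₂ z) (Σpts-comm r₁ r₂ (λ x y → z (x ++ y)))

    moment-marginal₁ : ∀ z i →
      Σpts R (λ c → z c * lookup c (i Fin.↑ˡ r₂)) ≡ Σpts r₁ (λ x → app marginal₁ z x * lookup x i)
    moment-marginal₁ z i = trans (Σpts-++ r₁ r₂ _) (Σpts-cong r₁ (λ x →
      trans (Σpts-cong r₂ (λ y → cong (z (x ++ y) *_) (V.lookup-++ˡ x y i)))
            (∑-*ʳ (allPts r₂) (lookup x i) (λ y → z (x ++ y)))))

    moment-marginal₂ : ∀ z i →
      Σpts R (λ c → z c * lookup c (r₁ Fin.↑ʳ i)) ≡ Σpts r₂ (λ y → app marginal₂ z y * lookup y i)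
    moment-marginal₂ z i = trans (Σpts-++ r₁ r₂ _) (trans (Σpts-comm r₁ r₂ _) (Σpts-cong r₂ (λ y →
      trans (Σpts-cong r₁ (λ x → cong (z (x ++ y) *_) (V.lookup-++ʳ x y i)))
            (∑-*ʳ (allPts r₁) (lookup y i) (λ x → z (x ++ y))))))

    D⇒Marginals : ∀ z → D R z → Marginals (D r₁) (D r₂) z
    D⇒Marginals z (Σz≈0 , moments≈0) =
      (≡⇒≈ (trans (sym (Σpts-marginal₁ z)) (≈⇒≡ Σz≈0)) ,
       λ i → ≡⇒≈ (trans (sym (moment-marginal₁ z i)) (≈⇒≡ (moments≈0 _)))) ,
      (≡⇒≈ (trans (sym (Σpts-marginal₂ z)) (≈⇒≡ Σz≈0)) ,
       λ i → ≡⇒≈ (trans (sym (moment-marginal₂ z i)) (≈⇒≡ (moments≈0 _))))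

    Marginals⇒D : ∀ z → Marginals (D r₁) (D r₂) z → D R z
    Marginals⇒D z ((ΣM₁z≈0 , moments₁≈0) , (_ , moments₂≈0)) =
      ≡⇒≈ (trans (Σpts-marginal₁ z) (≈⇒≡ ΣM₁z≈0)) , moment≈0
      where
        moment≈0 : ∀ i → Σpts R (λ c → z c * lookup c i) ≈ 0#
        moment≈0 i = subst (λ j → Σpts R (λ c → z c * lookup c j) ≈ 0#) (Fin.join-splitAt r₁ r₂ i)
                           (moment-join (Fin.splitAt r₁ i))
          where
            moment-join : ∀ s → Σpts R (λ c → z c * lookup c (Fin.join r₁ r₂ s)) ≈ 0#
            moment-join (inj₁ i₁) = ≡⇒≈ (trans (moment-marginal₁ z i₁) (≈⇒≡ (moments₁≈0 i₁)))
            moment-join (inj₂ i₂) = ≡⇒≈ (trans (moment-marginal₂ z i₂) (≈⇒≡ (moments₂≈0 i₂)))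

    module _ (τ₁ : Perm r₁) (τ₂ : Perm r₂) where

      bar-++ : ∀ x y → Inverse.to (bar τ₁ τ₂) (x ++ y) ≡ Inverse.to τ₁ x ++ Inverse.to τ₂ y
      bar-++ x y = cong₂ _++_ (cong (Inverse.to τ₁) (take-++ r₁ x y)) (cong (Inverse.to τ₂) (drop-++ r₁ x y))

      marginal₁-bar : ∀ z x →
        app marginal₁ (λ c → z (Inverse.to (bar τ₁ τ₂) c)) x ≡ app marginal₁ z (Inverse.to τ₁ x)
      marginal₁-bar z x = trans (Σpts-cong r₂ (λ y → cong z (bar-++ x y)))
                                (Σpts-permute r₂ τ₂ (λ y → z (Inverse.to τ₁ x ++ y)))

      marginal₂-bar : ∀ z y →
        app marginal₂ (λ c → z (Inverse.to (bar τ₁ τ₂) c)) y ≡ app marginal₂ z (Inverse.to τ₂ y)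
      marginal₂-bar z y = trans (Σpts-cong r₁ (λ x → cong z (bar-++ x y)))
                                (Σpts-permute r₁ τ₁ (λ x → z (x ++ Inverse.to τ₂ y)))

      Image-bar⇒Marginals : ∀ z → Image (bar τ₁ τ₂) (D R) z → Marginals (Image τ₁ (D r₁)) (Image τ₂ (D r₂)) z
      Image-bar⇒Marginals z z∈βD =
        let M₁∈D , M₂∈D = D⇒Marginals _ (Image-D⇒ R (bar τ₁ τ₂) z z∈βD)
        in Image-D⇐ r₁ τ₁ _ (D-resp r₁ (marginal₁-bar z) M₁∈D) ,
           Image-D⇐ r₂ τ₂ _ (D-resp r₂ (marginal₂-bar z) M₂∈D)

      Marginals⇒Image-bar : ∀ z → Marginals (Image τ₁ (D r₁)) (Image τ₂ (D r₂)) z → Image (bar τ₁ τ₂) (D R) z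
      Marginals⇒Image-bar z (M₁∈τ₁D , M₂∈τ₂D) = Image-D⇐ R (bar τ₁ τ₂) z (Marginals⇒D _
        (D-resp r₁ (λ x → sym (marginal₁-bar z x)) (Image-D⇒ r₁ τ₁ _ M₁∈τ₁D) ,
         D-resp r₂ (λ y → sym (marginal₂-bar z y)) (Image-D⇒ r₂ τ₂ _ M₂∈τ₂D)))

      D∩Image-dim : ∀ {d₁ d₂} →
        HasDim r₁ (D r₁ ∩ Image τ₁ (D r₁)) d₁ → HasDim r₂ (D r₂ ∩ Image τ₂ (D r₂)) d₂ →
        HasDim R (D R ∩ Image (bar τ₁ τ₂) (D R)) ((L.length offAxisPts ℕ.+ d₂) ℕ.+ d₁)
      D∩Image-dim I₁-dim I₂-dim = HasDim-cong
        (λ z ((M₁∈D , M₁∈τ₁D) , (M₂∈D , M₂∈τ₂D)) →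
           Marginals⇒D z (M₁∈D , M₂∈D) , Marginals⇒Image-bar z (M₁∈τ₁D , M₂∈τ₂D))
        (λ z (z∈D , z∈βD) →
           let M₁∈D , M₂∈D = D⇒Marginals z z∈D
               M₁∈τ₁D , M₂∈τ₂D = Image-bar⇒Marginals z z∈βD
           in (M₁∈D , M₁∈τ₁D) , (M₂∈D , M₂∈τ₂D))
        (Marginals-dim (D∩Image-ZeroSum r₁ τ₁) (D∩Image-ZeroSum r₂ τ₂) Marginals-Null-Null-dim I₁-dim I₂-dim)

    D-dim : ∀ {d₁ d₂} → HasDim r₁ (D r₁) d₁ → HasDim r₂ (D r₂) d₂ →
      HasDim R (D R) ((L.length offAxisPts ℕ.+ d₂) ℕ.+ d₁)
    D-dim D₁-dim D₂-dim = HasDim-cong Marginals⇒D D⇒Marginals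
      (Marginals-dim (D-ZeroSum r₁) (D-ZeroSum r₂) Marginals-Null-Null-dim D₁-dim D₂-dim)

-- Only from here on is _+_ the addition of ℕ rather than of the field.
open import Data.Nat using (_+_)

distension-+ : ∀ k b₁ b₂ l₁ l₂ {a₁ a₂} → a₁ ≡ l₁ + b₁ → a₂ ≡ l₂ + b₂ →
  (k + a₂) + a₁ ≡ (l₁ + l₂) + ((k + b₂) + b₁)
distension-+ k b₁ b₂ l₁ l₂ refl refl =
  solve 5 (λ k b₁ b₂ l₁ l₂ → (k :+ (l₂ :+ b₂)) :+ (l₁ :+ b₁) := (l₁ :+ l₂) :+ ((k :+ b₂) :+ b₁)) refl k b₁ b₂ l₁ l₂
  where open +-*-Solver

theorem4 : ∀ {q : ℕ} (F : FiniteField q) (r₁ r₂ : ℕ) → r₁ ≥ 1 → r₂ ≥ 1 →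
    (τ₁ : Code.Perm F r₁) (τ₂ : Code.Perm F r₂) (l₁ l₂ : ℕ) →
    Code.Distension F r₁ τ₁ l₁ → Code.Distension F r₂ τ₂ l₂ →
    Inverse.to τ₁ (Code.zeroPt F r₁) ≡ Code.zeroPt F r₁ →
    Inverse.to τ₂ (Code.zeroPt F r₂) ≡ Code.zeroPt F r₂ →
    Code.Distension F (r₁ + r₂) (Code.bar F τ₁ τ₂) (l₁ + l₂)
theorem4 F r₁ r₂ _ _ τ₁ τ₂ l₁ l₂ (a₁ , b₁ , D₁-dim , I₁-dim , a₁≡l₁+b₁)
                                 (a₂ , b₂ , D₂-dim , I₂-dim , a₂≡l₂+b₂) _ _ =
  (k + a₂) + a₁ , (k + b₂) + b₁ , D-dim D₁-dim D₂-dim , D∩Image-dim τ₁ τ₂ I₁-dim I₂-dim ,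
  distension-+ k b₁ b₂ l₁ l₂ a₁≡l₁+b₁ a₂≡l₂+b₂
  where
    open Blocks F r₁ r₂
    k = L.length offAxisPts
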